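{- The variety $\mathsf{EnSM}^-$ is term-equivalent to the variety $\mathsf{bRSA}$, and $\mathsf{EnSM}^-_\bot$ is term-equivalent to $\mathsf{bGA}$. Specifically, in every member of $\mathsf{EnSM}^-$ one has $Na=f\to a$, its $(\wedge,\vee,\to,t,f)$-reduct is a bRS-algebra, and conversely every bRS-algebra expanded by $Na=f\to a$ is a member of $\mathsf{EnSM}^-$ (and similarly in the bounded case).
   Context: A relative Stone algebra is $(A,\wedge,\vee,\to,t)$ with $(A,\wedge,\vee)$ a lattice with top $t$, $a\wedge b\le c\iff a\le b\to c$, and $(a\to b)\vee(b\to a)=t$; a Gödel algebra is a relative Stone algebra expanded by a least element $\bot$. A nucleus is a closure operator $N$ with $Na\wedge Nb\le N(a\wedge b)$. $\mathsf{EnSM}^-$ is the class of algebras $(A,\wedge,\vee,\to,t,N,f)$ with $(A,\wedge,\vee,\to,t)$ a relative Stone algebra, $N$ a nucleus, $f\in A$, satisfying $a\vee(a\to f)=t$, $N(Na\to a)=t$, and $Na=t\iff f\le a$; $\mathsf{EnSM}^-_\bot$ is the class of their expansions by a least element $\bot$. $\mathsf{bRSA}$ is the class of algebras $(A,\wedge,\vee,\to,t,f)$ with $(A,\wedge,\vee,\to,t)$ a relative Stone algebra and $a\vee(a\to f)=t$ for all $a$; $\mathsf{bGA}$ is the analogous class over Gödel algebras $(A,\wedge,\vee,\to,t,\bot,f)$. -}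

module Defs where

open import Level using (Level)
open import Data.Product using (_×_)
open import Relation.Binary.PropositionalEquality using (_≡_)
open import Algebra.Core using (Op₁; Op₂)
open import Algebra.Lattice.Structures using (IsLattice)

module _ {ℓ : Level} {A : Set ℓ} where

  infix 4 _≤[_]_
  _≤[_]_ : A → Op₂ A → A → Set ℓ
  a ≤[ _∧_ ] b = (a ∧ b) ≡ a

  record IsRSA (_∧_ _∨_ _⇒_ : Op₂ A) (t : A) : Set ℓ where
    field
      isLattice    : IsLattice _≡_ _∨_ _∧_
      top          : ∀ a → a ≤[ _∧_ ] t
      residuation  : ∀ a b c → ((a ∧ b) ≤[ _∧_ ] c → a ≤[ _∧_ ] (b ⇒ c))
                               × (a ≤[ _∧_ ] (b ⇒ c) → (a ∧ b) ≤[ _∧_ ] c)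
      prelinearity : ∀ a b → ((a ⇒ b) ∨ (b ⇒ a)) ≡ t

  record IsGA (_∧_ _∨_ _⇒_ : Op₂ A) (t ⊥ : A) : Set ℓ where
    field
      isRSA  : IsRSA _∧_ _∨_ _⇒_ t
      bottom : ∀ a → ⊥ ≤[ _∧_ ] a

  record IsNucleus (_∧_ : Op₂ A) (N : Op₁ A) : Set ℓ where
    field
      extensive  : ∀ a → a ≤[ _∧_ ] N a
      monotone   : ∀ a b → a ≤[ _∧_ ] b → N a ≤[ _∧_ ] N b
      idempotent : ∀ a → N (N a) ≡ N a
      meet       : ∀ a b → (N a ∧ N b) ≤[ _∧_ ] N (a ∧ b)

  record IsBRSA (_∧_ _∨_ _⇒_ : Op₂ A) (t f : A) : Set ℓ where
    field
      isRSA : IsRSA _∧_ _∨_ _⇒_ t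
      f-ax  : ∀ a → (a ∨ (a ⇒ f)) ≡ t

  record IsBGA (_∧_ _∨_ _⇒_ : Op₂ A) (t ⊥ f : A) : Set ℓ where
    field
      isGA : IsGA _∧_ _∨_ _⇒_ t ⊥
      f-ax : ∀ a → (a ∨ (a ⇒ f)) ≡ t

  record IsEnSM⁻ (_∧_ _∨_ _⇒_ : Op₂ A) (t : A) (N : Op₁ A) (f : A) : Set ℓ where
    field
      isRSA     : IsRSA _∧_ _∨_ _⇒_ t
      isNucleus : IsNucleus _∧_ N
      f-ax      : ∀ a → (a ∨ (a ⇒ f)) ≡ t
      N-ax      : ∀ a → N (N a ⇒ a) ≡ t
      N-top     : ∀ a → (N a ≡ t → f ≤[ _∧_ ] a) × (f ≤[ _∧_ ] a → N a ≡ t)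

  record IsEnSM⁻⊥ (_∧_ _∨_ _⇒_ : Op₂ A) (t ⊥ : A) (N : Op₁ A) (f : A) : Set ℓ where
    field
      isEnSM⁻ : IsEnSM⁻ _∧_ _∨_ _⇒_ t N f
      bottom  : ∀ a → ⊥ ≤[ _∧_ ] a

module Submission where

-- Everything rests on two facts about a Brouwerian lattice, i.e. a lattice
-- with top t and a residuated implication ⇒:
--
--  * for every element f, the map a ↦ f ⇒ a is a nucleus satisfying the two
--    EnSM⁻ axioms  f ⇒ ((f ⇒ a) ⇒ a) = t  and  (f ⇒ a = t ⇔ f ≤ a);
--  * conversely, a nucleus N satisfying those two axioms must be f ⇒ (-):
--    from N (N a ⇒ a) = t we get f ≤ N a ⇒ a, hence N a ≤ f ⇒ a; and since
--    f ≤ (f ⇒ a) ⇒ a we get N ((f ⇒ a) ⇒ a) = t, which a nucleus turns into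
--    N (f ⇒ a) ≤ N a, hence f ⇒ a ≤ N a.

open import Defs
open import Level using (Level)
open import Data.Product using (_×_; _,_; proj₁; proj₂)
open import Relation.Binary.PropositionalEquality using (_≡_; sym; subst)
open import Algebra.Core using (Op₁; Op₂)
open import Algebra.Lattice.Bundles using (Lattice)
open import Algebra.Lattice.Structures using (IsLattice)
import Algebra.Lattice.Properties.Lattice as LatticeProperties
open import Relation.Binary.Lattice using (MeetSemilattice)

-- The order a ≤ b :⇔ a ∧ b ≡ a of a lattice.  The standard library's
-- natural order is the symmetric x ≡ x ∧ y, so its lemmas transfer by sym.
module Order {ℓ : Level} {A : Set ℓ} {_∧_ _∨_ : Op₂ A}
             (isLattice : IsLattice _≡_ _∨_ _∧_) where

  infix 4 _≤_
  _≤_ : A → A → Set ℓ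
  a ≤ b = a ≤[ _∧_ ] b

  private
    lattice : Lattice ℓ ℓ
    lattice = record { isLattice = isLattice }
    module M = MeetSemilattice
      (LatticeProperties.∧-orderTheoreticMeetSemilattice lattice)

  ≤-refl : ∀ {a} → a ≤ a
  ≤-refl = sym M.refl

  ≤-trans : ∀ {a b c} → a ≤ b → b ≤ c → a ≤ c
  ≤-trans p q = sym (M.trans (sym p) (sym q))

  ≤-antisym : ∀ {a b} → a ≤ b → b ≤ a → a ≡ b
  ≤-antisym p q = M.antisym (sym p) (sym q)

  x∧y≤x : ∀ {a b} → (a ∧ b) ≤ a
  x∧y≤x {a} {b} = sym (M.x∧y≤x a b)

  x∧y≤y : ∀ {a b} → (a ∧ b) ≤ b
  x∧y≤y {a} {b} = sym (M.x∧y≤y a b)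

  ∧-greatest : ∀ {a b c} → a ≤ b → a ≤ c → a ≤ (b ∧ c)
  ∧-greatest p q = sym (M.∧-greatest (sym p) (sym q))

  ∧-monoˡ : ∀ {a b c} → a ≤ b → (a ∧ c) ≤ (b ∧ c)
  ∧-monoˡ p = ∧-greatest (≤-trans x∧y≤x p) x∧y≤y

  ∧-swap : ∀ {a b} → (a ∧ b) ≤ (b ∧ a)
  ∧-swap = ∧-greatest x∧y≤y x∧y≤x

module Brouwerian {ℓ : Level} {A : Set ℓ} {_∧_ _∨_ _⇒_ : Op₂ A} {t : A}
  (isLattice   : IsLattice _≡_ _∨_ _∧_)
  (top         : ∀ a → a ≤[ _∧_ ] t)
  (residuation : ∀ a b c → ((a ∧ b) ≤[ _∧_ ] c → a ≤[ _∧_ ] (b ⇒ c))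
                           × (a ≤[ _∧_ ] (b ⇒ c) → (a ∧ b) ≤[ _∧_ ] c))
  where

  open Order isLattice public

  curry : ∀ {a b c} → (a ∧ b) ≤ c → a ≤ (b ⇒ c)
  curry {a} {b} {c} = proj₁ (residuation a b c)

  uncurry : ∀ {a b c} → a ≤ (b ⇒ c) → (a ∧ b) ≤ c
  uncurry {a} {b} {c} = proj₂ (residuation a b c)

  modus-ponens : ∀ {a b} → ((a ⇒ b) ∧ a) ≤ b
  modus-ponens = uncurry ≤-refl

  ≤-⇒-⇒ : ∀ {a b} → a ≤ ((a ⇒ b) ⇒ b)
  ≤-⇒-⇒ = curry (≤-trans ∧-swap modus-ponens)

  ⇒-monoʳ : ∀ {a b c} → b ≤ c → (a ⇒ b) ≤ (a ⇒ c)
  ⇒-monoʳ p = curry (≤-trans modus-ponens p)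

  ⇒≡t⇒≤ : ∀ {a b} → (a ⇒ b) ≡ t → a ≤ b
  ⇒≡t⇒≤ {a} e = ≤-trans (∧-greatest (top a) ≤-refl)
                        (uncurry (subst (t ≤_) (sym e) ≤-refl))

  ≤⇒⇒≡t : ∀ {a b} → a ≤ b → (a ⇒ b) ≡ t
  ≤⇒⇒≡t p = ≤-antisym (top _) (curry (≤-trans x∧y≤y p))

  ⇒-isNucleus : ∀ f → IsNucleus _∧_ (f ⇒_)
  ⇒-isNucleus f = record
    { extensive  = λ _ → curry x∧y≤x
    ; monotone   = λ _ _ → ⇒-monoʳ
    ; idempotent = λ _ → ≤-antisym
        (curry (≤-trans (∧-greatest modus-ponens x∧y≤y) modus-ponens))
        (curry x∧y≤x)
    ; meet       = λ _ _ → curry (∧-greatest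
        (≤-trans (∧-monoˡ x∧y≤x) modus-ponens)
        (≤-trans (∧-monoˡ x∧y≤y) modus-ponens))
    }

  nucleus-⇒ : ∀ {N} → IsNucleus _∧_ N → ∀ {a b} → N (a ⇒ b) ≤ (N a ⇒ N b)
  nucleus-⇒ {N} isNucleus {a} {b} =
    curry (≤-trans (meet (a ⇒ b) a) (monotone _ _ modus-ponens))
    where open IsNucleus isNucleus

  nucleus-unique : ∀ {N f} → IsNucleus _∧_ N →
    (∀ a → N (N a ⇒ a) ≡ t) →
    (∀ a → (N a ≡ t → f ≤ a) × (f ≤ a → N a ≡ t)) →
    ∀ a → N a ≡ (f ⇒ a)
  nucleus-unique {N} {f} isNucleus N-ax N-top a =
    ≤-antisym N≤f⇒ f⇒≤N
    where
    open IsNucleus isNucleus using (extensive)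

    f≤Na⇒a : f ≤ (N a ⇒ a)
    f≤Na⇒a = proj₁ (N-top (N a ⇒ a)) (N-ax a)

    N≤f⇒ : N a ≤ (f ⇒ a)
    N≤f⇒ = curry (≤-trans ∧-swap (uncurry f≤Na⇒a))

    -- N ((f ⇒ a) ⇒ a) = t, so N (f ⇒ a) ⇒ N a is the top element.
    Nf⇒≤N : N (f ⇒ a) ≤ N a
    Nf⇒≤N = ⇒≡t⇒≤ (≤-antisym (top _)
      (subst (_≤ (N (f ⇒ a) ⇒ N a)) (proj₂ (N-top _) ≤-⇒-⇒)
             (nucleus-⇒ isNucleus)))

    f⇒≤N : (f ⇒ a) ≤ N a
    f⇒≤N = ≤-trans (extensive (f ⇒ a)) Nf⇒≤N

module RSA {ℓ : Level} {A : Set ℓ} {_∧_ _∨_ _⇒_ : Op₂ A} {t : A}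
           (isRSA : IsRSA _∧_ _∨_ _⇒_ t) where
  open IsRSA isRSA
  open Brouwerian {_⇒_ = _⇒_} isLattice top residuation public

module _ {ℓ : Level} {A : Set ℓ} {_∧_ _∨_ _⇒_ : Op₂ A} {t f : A} where

  EnSM⁻-N≡f⇒ : ∀ {N} → IsEnSM⁻ _∧_ _∨_ _⇒_ t N f → ∀ a → N a ≡ (f ⇒ a)
  EnSM⁻-N≡f⇒ E = RSA.nucleus-unique isRSA isNucleus N-ax N-top
    where open IsEnSM⁻ E

  EnSM⁻⇒bRSA : ∀ {N} → IsEnSM⁻ _∧_ _∨_ _⇒_ t N f → IsBRSA _∧_ _∨_ _⇒_ t f
  EnSM⁻⇒bRSA E = record { isRSA = isRSA ; f-ax = f-ax }
    where open IsEnSM⁻ E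

  bRSA⇒EnSM⁻ : IsBRSA _∧_ _∨_ _⇒_ t f → IsEnSM⁻ _∧_ _∨_ _⇒_ t (f ⇒_) f
  bRSA⇒EnSM⁻ B = record
    { isRSA     = isRSA
    ; isNucleus = ⇒-isNucleus f
    ; f-ax      = f-ax
    ; N-ax      = λ _ → ≤⇒⇒≡t ≤-⇒-⇒
    ; N-top     = λ _ → ⇒≡t⇒≤ , ≤⇒⇒≡t
    }
    where
    open IsBRSA B
    open RSA isRSA

  EnSM⁻⊥⇒bGA : ∀ {⊥ N} → IsEnSM⁻⊥ _∧_ _∨_ _⇒_ t ⊥ N f → IsBGA _∧_ _∨_ _⇒_ t ⊥ f
  EnSM⁻⊥⇒bGA E = record
    { isGA = record { isRSA = IsBRSA.isRSA B ; bottom = bottom }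
    ; f-ax = IsBRSA.f-ax B
    }
    where
    open IsEnSM⁻⊥ E
    B : IsBRSA _∧_ _∨_ _⇒_ t f
    B = EnSM⁻⇒bRSA isEnSM⁻

  bGA⇒EnSM⁻⊥ : ∀ {⊥} → IsBGA _∧_ _∨_ _⇒_ t ⊥ f → IsEnSM⁻⊥ _∧_ _∨_ _⇒_ t ⊥ (f ⇒_) f
  bGA⇒EnSM⁻⊥ G = record
    { isEnSM⁻ = bRSA⇒EnSM⁻ (record { isRSA = IsGA.isRSA isGA ; f-ax = f-ax })
    ; bottom  = IsGA.bottom isGA
    }
    where open IsBGA G

mainTheorem7 : ∀ {ℓ : Level} {A : Set ℓ} (_∧_ _∨_ _⇒_ : Op₂ A) (t ⊥ f : A) (N : Op₁ A) →
    ((IsEnSM⁻ _∧_ _∨_ _⇒_ t N f → (∀ a → N a ≡ (f ⇒ a)) × IsBRSA _∧_ _∨_ _⇒_ t f)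
    × (IsBRSA _∧_ _∨_ _⇒_ t f → IsEnSM⁻ _∧_ _∨_ _⇒_ t (λ a → f ⇒ a) f))
    × ((IsEnSM⁻⊥ _∧_ _∨_ _⇒_ t ⊥ N f → (∀ a → N a ≡ (f ⇒ a)) × IsBGA _∧_ _∨_ _⇒_ t ⊥ f)
    × (IsBGA _∧_ _∨_ _⇒_ t ⊥ f → IsEnSM⁻⊥ _∧_ _∨_ _⇒_ t ⊥ (λ a → f ⇒ a) f))
mainTheorem7 _ _ _ _ _ _ _ =
  ( (λ E → EnSM⁻-N≡f⇒ E , EnSM⁻⇒bRSA E)
  , bRSA⇒EnSM⁻ )
  , ( (λ E → EnSM⁻-N≡f⇒ (IsEnSM⁻⊥.isEnSM⁻ E) , EnSM⁻⊥⇒bGA E)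
    , bGA⇒EnSM⁻⊥ )
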